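{- Let $G$ be a finite connected graph and let $x \in V(G)$. A set $S \subseteq V(G)$ is $x$-geodominating if and only if $\partial(x) \subseteq S$.
   Context: Graphs are simple. $d(u,v)$ denotes the shortest-path distance in $G$ and $N(v)$ the set of neighbours of $v$. The interval $I[u,v]$ is the set of vertices lying on some shortest $u$–$v$ path (geodesic). A vertex $y$ $x$-geodominates a vertex $u$ if $u \in I[x,y]$. A set $S \subseteq V(G)$ is $x$-geodominating if every vertex of $G$ is $x$-geodominated by some element of $S$, i.e. $V(G) = \bigcup_{s \in S} I[x,s]$. The boundary of $x$ is $\partial(x) = \{ v \in V(G) : d(x,w) \le d(x,v) \text{ for all } w \in N(v)\}$. -}

module Defs where

open import Data.Nat using (ℕ; zero; suc; _+_; _≤_)
open import Data.Fin using (Fin)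
open import Data.Fin.Subset using (Subset; _∈_; _⊆_)
open import Data.Product using (Σ; ∃; _×_; _,_)
open import Data.Sum using (_⊎_)
open import Data.Empty using (⊥)
open import Relation.Nullary using (¬_; Dec)
open import Relation.Binary.PropositionalEquality using (_≡_)

record Graph : Set₁ where
  field
    n      : ℕ
    Adj    : Fin n → Fin n → Set
    adj?   : ∀ u v → Dec (Adj u v)
    sym    : ∀ {u v} → Adj u v → Adj v u
    irrefl : ∀ {u} → ¬ Adj u u

module _ (G : Graph) where
  open Graph G

  V : Set
  V = Fin n

  data Walk : V → V → ℕ → Set where
    [_]  : ∀ v → Walk v v zero
    _∷_  : ∀ {u w v k} → Adj u w → Walk w v k → Walk u v (suc k)

  OnWalk : ∀ {u v k} → V → Walk u v k → Set
  OnWalk z [ v ] = z ≡ v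
  OnWalk {u} z (_∷_ {w = _} e p) = z ≡ u ⊎ OnWalk z p

  Connected : Set
  Connected = ∀ u v → ∃ λ k → Walk u v k

  IsDist : V → V → ℕ → Set
  IsDist u v k = Walk u v k × (∀ m → Walk u v m → k ≤ m)

  InInterval : V → V → V → Set
  InInterval u x y = ∃ λ k → Σ (Walk x y k) λ p → IsDist x y k × OnWalk u p

  Geodominating : V → Subset n → Set
  Geodominating x S = ∀ u → ∃ λ s → s ∈ S × InInterval u x s

  InBoundary : V → V → Set
  InBoundary x v = ∀ w → Adj v w → ∀ a b → IsDist x w a → IsDist x v b → a ≤ b

  BoundaryIn : V → Subset n → Set
  BoundaryIn x S = ∀ v → InBoundary x v → v ∈ S

-- Along a geodesic from x every vertex is strictly closer to x than its successor, so a
-- vertex of ∂(x) can only occur on an x-geodesic as its endpoint: this forces ∂(x) ⊆ S.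
-- Conversely, a geodesic from x to u can be extended edge by edge, each time to a
-- neighbour farther from x, until it ends in a vertex of ∂(x); distances from x are
-- bounded, so this terminates, and the final geodesic passes through u.
module Submission where

open import Defs
open import Data.Fin using (Fin; zero; suc; toℕ; fromℕ<; _≟_)
open import Data.Fin.Properties using (any?; toℕ<n; toℕ-fromℕ<)
open import Data.Fin.Subset using (Subset; _∈_)
open import Data.Nat using (ℕ; zero; suc; _+_; _⊔_; _≤_; _<_; _<?_)
open import Data.Nat.Properties
  using (≤-trans; ≤-antisym; ≮⇒≥; +-suc; +-cancelʳ-≤; 1+n≰n; m≤m+n; m≤m⊔n; m≤n⊔m)
open import Data.Nat.Induction using (<-wellFounded)
open import Data.Product using (∃; _×_; _,_; proj₁; proj₂)
open import Data.Sum using (_⊎_; inj₁; inj₂)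
open import Data.Empty using (⊥-elim)
open import Induction.WellFounded using (Acc; acc)
open import Relation.Nullary using (Dec; yes; no)
open import Relation.Nullary.Decidable using (_×-dec_)
open import Relation.Unary using (Decidable)
open import Relation.Binary.PropositionalEquality using (_≡_; refl; sym; subst)

Minimum : (ℕ → Set) → Set
Minimum P = ∃ λ m → P m × (∀ j → P j → m ≤ j)

minimum : {P : ℕ → Set} → Decidable P → ∀ {k} → P k → Minimum P
minimum {P} P? {k} = search k (<-wellFounded k)
  where
  search : ∀ k → Acc _<_ k → P k → Minimum P
  search k (acc rs) pk with any? (λ (i : Fin k) → P? (toℕ i))
  ... | yes (i , pi) = search (toℕ i) (rs (toℕ<n i)) pi
  ... | no none = k , pk , λ j pj → ≮⇒≥ λ j<k →
    none (fromℕ< j<k , subst P (sym (toℕ-fromℕ< j<k)) pj)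

finite-bounded : ∀ {k} (f : Fin k → ℕ) → ∃ λ B → ∀ i → f i ≤ B
finite-bounded {zero} f = 0 , λ ()
finite-bounded {suc k} f with finite-bounded (λ i → f (suc i))
... | B , f≤B = f zero ⊔ B , λ where
  zero    → m≤m⊔n (f zero) B
  (suc i) → ≤-trans (f≤B i) (m≤n⊔m (f zero) B)

module Walks (G : Graph) where
  open Graph G using (Adj; adj?)

  infixr 5 _++_
  infixl 5 _∷ʳ_

  _++_ : ∀ {a b c i j} → Walk G a b i → Walk G b c j → Walk G a c (i + j)
  [ _ ]   ++ q = q
  (e ∷ p) ++ q = e ∷ (p ++ q)

  _∷ʳ_ : ∀ {a b c i} → Walk G a b i → Adj b c → Walk G a c (suc i)
  [ _ ]    ∷ʳ e = e ∷ [ _ ]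
  (e′ ∷ p) ∷ʳ e = e′ ∷ (p ∷ʳ e)

  onWalk-∷ʳ : ∀ {a b c i z} (p : Walk G a b i) (e : Adj b c) → OnWalk G z p → OnWalk G z (p ∷ʳ e)
  onWalk-∷ʳ [ _ ]    e z≡b      = inj₁ z≡b
  onWalk-∷ʳ (_ ∷ p)  e (inj₁ z≡a) = inj₁ z≡a
  onWalk-∷ʳ (_ ∷ p)  e (inj₂ o)   = inj₂ (onWalk-∷ʳ p e o)

  onWalk-end : ∀ {a b i} (p : Walk G a b i) → OnWalk G b p
  onWalk-end [ _ ]   = refl
  onWalk-end (_ ∷ p) = inj₂ (onWalk-end p)

  onWalk⇒split : ∀ {a b k z} (p : Walk G a b k) → OnWalk G z p →
                 ∃ λ i → ∃ λ j → Walk G a z i × Walk G z b j × k ≡ i + j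
  onWalk⇒split [ _ ] refl = 0 , 0 , [ _ ] , [ _ ] , refl
  onWalk⇒split {k = k} (e ∷ p) (inj₁ refl) = 0 , k , [ _ ] , e ∷ p , refl
  onWalk⇒split (e ∷ p) (inj₂ o) with onWalk⇒split p o
  ... | i , j , q , r , refl = suc i , j , e ∷ q , r , refl

  walk? : ∀ m u v → Dec (Walk G u v m)
  walk? zero u v with u ≟ v
  ... | yes refl = yes [ u ]
  ... | no u≢v   = no λ { [ _ ] → u≢v refl }
  walk? (suc m) u v with any? (λ w → adj? u w ×-dec walk? m w v)
  ... | yes (w , e , p) = yes (e ∷ p)
  ... | no none         = no λ { (e ∷ p) → none (_ , e , p) }

  isDist-unique : ∀ {u v a b} → IsDist G u v a → IsDist G u v b → a ≡ b
  isDist-unique (p , p-min) (q , q-min) = ≤-antisym (p-min _ q) (q-min _ p)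

  isDist-prefix : ∀ {u z v i j} → IsDist G u v (i + j) → Walk G u z i → Walk G z v j → IsDist G u z i
  isDist-prefix {i = i} {j} (_ , min) q r =
    q , λ m q′ → +-cancelʳ-≤ j i m (min (m + j) (q′ ++ r))

  boundary-only-at-end : ∀ {x z s k} (p : Walk G x s k) → IsDist G x s k →
                         OnWalk G z p → InBoundary G x z → z ≡ s
  boundary-only-at-end p D o z∈∂ with onWalk⇒split p o
  ... | i , zero    , q , [ _ ] , refl = refl
  ... | i , suc j   , q , e ∷ r , refl =
    ⊥-elim (1+n≰n (z∈∂ _ e (suc i) i (isDist-prefix D′ (q ∷ʳ e) r) (isDist-prefix D q (e ∷ r))))
    where
    D′ : IsDist G _ _ (suc i + j)
    D′ = subst (IsDist G _ _) (+-suc i j) D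

  geodominating⇒boundaryIn : ∀ {x} S → Geodominating G x S → BoundaryIn G x S
  geodominating⇒boundaryIn S geo v v∈∂ with geo v
  ... | s , s∈S , k , p , D , o with boundary-only-at-end p D o v∈∂
  ... | refl = s∈S

module Distances (G : Graph) (conn : Connected G) (x : V G) where
  open Graph G using (Adj; adj?)
  open Walks G

  private
    distance : ∀ v → Minimum (λ m → Walk G x v m)
    distance v = minimum (λ m → walk? m x v) (proj₂ (conn x v))

  d : V G → ℕ
  d v = proj₁ (distance v)

  d-isDist : ∀ v → IsDist G x v (d v)
  d-isDist v = proj₂ (distance v)

  boundary-or-farther : ∀ u → InBoundary G x u ⊎ ∃ λ w → Adj u w × d u < d w
  boundary-or-farther u with any? (λ w → adj? u w ×-dec (d u <? d w))
  ... | yes farther = inj₂ farther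
  ... | no none     = inj₁ λ w e a b Da Db →
    subst (_≤ b) (isDist-unique (d-isDist w) Da)
      (subst (d w ≤_) (isDist-unique (d-isDist u) Db) (≮⇒≥ λ lt → none (w , e , lt)))

  isDist-extend : ∀ {u w k} (p : Walk G x u k) → IsDist G x u k → Adj u w → d u < d w →
                  IsDist G x w (suc k)
  isDist-extend {u} p D e lt with isDist-unique D (d-isDist u)
  ... | refl = p ∷ʳ e , λ m q → ≤-trans lt (proj₂ (d-isDist _) m q)

  B : ℕ
  B = proj₁ (finite-bounded d)

  d≤B : ∀ v → d v ≤ B
  d≤B = proj₂ (finite-bounded d)

  -- Each extension raises k = d u by one and d ≤ B, so the fuel t bounds the remaining extensions.
  geodesic-covered : ∀ S → BoundaryIn G x S → ∀ t {u k} (p : Walk G x u k) → IsDist G x u k → B ≤ t + k →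
                     ∀ z → OnWalk G z p → ∃ λ s → s ∈ S × InInterval G z x s
  geodesic-covered S ∂⊆S t {u} {k} p D bound z o with boundary-or-farther u
  ... | inj₁ u∈∂ = u , ∂⊆S u u∈∂ , k , p , D , o
  ... | inj₂ (w , e , du<dw) with t
  ...   | zero = ⊥-elim (1+n≰n (≤-trans du<dw (≤-trans (d≤B w) (subst (B ≤_) du≡k bound))))
    where du≡k = isDist-unique D (d-isDist u)
  ...   | suc t′ = geodesic-covered S ∂⊆S t′ (p ∷ʳ e) (isDist-extend p D e du<dw)
                     (subst (B ≤_) (sym (+-suc t′ k)) bound) z (onWalk-∷ʳ p e o)

  boundaryIn⇒geodominating : ∀ S → BoundaryIn G x S → Geodominating G x S
  boundaryIn⇒geodominating S ∂⊆S u =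
    geodesic-covered S ∂⊆S B p (d-isDist u) (m≤m+n B _) u (onWalk-end p)
    where p = proj₁ (d-isDist u)

theorem1 : (G : Graph) → Connected G → (x : V G) → (S : Subset (Graph.n G)) →
    (Geodominating G x S → BoundaryIn G x S) × (BoundaryIn G x S → Geodominating G x S)
theorem1 G conn x S =
  Walks.geodominating⇒boundaryIn G S , Distances.boundaryIn⇒geodominating G conn x S
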